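{- Let $\mathbb{F}$ be a finite field of characteristic $p$, let $\eta_1,\eta_2\in\mathbb{F}_p[y]$ be additive polynomials, and let $H_i=\eta_i(\mathbb{F}[t])$ for $i=1,2$. Then there exists an additive polynomial $\eta\in\mathbb{F}_p[y]$ with $\eta(\mathbb{F}[t]) = H_1+H_2$. Moreover, $\eta = \eta_1\circ\zeta_1+\eta_2\circ\zeta_2$ for some additive polynomials $\zeta_1,\zeta_2\in\mathbb{F}_p[y]$.
   Context: A polynomial $\eta$ is additive if $\eta(x+y)=\eta(x)+\eta(y)$ identically (equivalently, $\eta(y)=\sum_j c_jy^{p^j}$). -}

module Defs where

open import Level using (Level; _⊔_) renaming (suc to lsuc)
open import Algebra.Bundles using (CommutativeRing)
open import Data.Nat using (ℕ; zero; suc; _^_)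
open import Data.List using (List; []; _∷_; map)
open import Data.List.Relation.Unary.Any using (Any)
open import Data.Product using (Σ; ∃; ∃₂; _×_)
open import Relation.Nullary using (¬_)
open import Relation.Binary.PropositionalEquality using (_≡_)

record FiniteField c ℓ : Set (lsuc (c ⊔ ℓ)) where
  field
    commutativeRing : CommutativeRing c ℓ
  open CommutativeRing commutativeRing public
  field
    1≉0      : ¬ (1# ≈ 0#)
    inverse  : ∀ x → ¬ (x ≈ 0#) → ∃ λ y → x * y ≈ 1#
    elements : List Carrier
    finite   : ∀ x → Any (x ≈_) elements

module FF {c ℓ} (F : FiniteField c ℓ) where
  open FiniteField F

  natToF : ℕ → Carrier
  natToF zero    = 0#
  natToF (suc n) = 1# + natToF n

  -- Polynomials in one variable over F, as coefficient lists
  -- (constant coefficient first).  Used both for F[t] and for F[y].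
  Poly : Set c
  Poly = List Carrier

  coeff : Poly → ℕ → Carrier
  coeff []      _       = 0#
  coeff (a ∷ f) zero    = a
  coeff (a ∷ f) (suc n) = coeff f n

  -- equality of polynomials (coefficientwise; trailing zeros irrelevant)
  _≈P_ : Poly → Poly → Set ℓ
  f ≈P g = ∀ n → coeff f n ≈ coeff g n

  infix 4 _≈P_
  infixl 6 _+P_
  infixl 7 _*P_
  infixr 9 _∘P_

  _+P_ : Poly → Poly → Poly
  []      +P g       = g
  (a ∷ f) +P []      = a ∷ f
  (a ∷ f) +P (b ∷ g) = (a + b) ∷ (f +P g)

  _*P_ : Poly → Poly → Poly
  []      *P g = []
  (a ∷ f) *P g = map (a *_) g +P (0# ∷ (f *P g))

  _∘P_ : Poly → Poly → Poly
  []      ∘P g = []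
  (a ∷ f) ∘P g = (a ∷ []) +P (g *P (f ∘P g))

  InPrimeField : Poly → Set ℓ
  InPrimeField η = ∀ n → ∃ λ (k : ℕ) → coeff η n ≈ natToF k

  -- additive polynomial (p-polynomial): η(y) = Σ_j c_j y^(p^j),
  -- i.e. the coefficient of y^n vanishes unless n is a power of p
  Additive : ℕ → Poly → Set ℓ
  Additive p η = ∀ n → (∀ j → ¬ (n ≡ p ^ j)) → coeff η n ≈ 0#

  AdditiveFp : ℕ → Poly → Set ℓ
  AdditiveFp p η = InPrimeField η × Additive p η

  -- h ∈ η(F[t])  (evaluation of η ∈ F_p[y] at f ∈ F[t] is η ∘ f)
  _∈Im_ : Poly → Poly → Set (c ⊔ ℓ)
  h ∈Im η = ∃ λ f → h ≈P η ∘P f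

  InSum : Poly → Poly → Poly → Set (c ⊔ ℓ)
  InSum η₁ η₂ h = ∃₂ λ f g → h ≈P (η₁ ∘P f) +P (η₂ ∘P g)

-- Send c(y) = Σ cⱼ yʲ ∈ 𝔽ₚ[y] to its linearised associate L_c(y) = Σ cⱼ y^(pʲ). Since Frobenius is
-- additive and fixes 𝔽ₚ, L_c is additive and L_(c·e) = L_c ∘ L_e; every additive η ∈ 𝔽ₚ[y] is some L_c.
-- Write ηᵢ = L_(cᵢ) and run Euclid in 𝔽ₚ[y]: d = c₁z₁ + c₂z₂ with cᵢ = d uᵢ. Then η = L_d satisfies
-- η = η₁ ∘ L_(z₁) + η₂ ∘ L_(z₂), giving η(F[t]) ⊆ H₁ + H₂, and ηᵢ = η ∘ L_(uᵢ), which with the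
-- additivity of η gives H₁ + H₂ ⊆ η(F[t]).

module Submission where

open import Defs
open import Algebra.Bundles using (CommutativeRing; AbelianGroup)
open import Algebra.Structures using (IsAbelianGroup)
open import Data.Nat as ℕ using (ℕ; zero; suc; _<_; _≤_; z≤n; s≤s; z<s; s<s; NonZero; _!)
import Data.Nat.Properties as ℕₚ
open import Data.Nat.Properties using (_!*_!≢0)
open import Data.Nat.DivMod using (m/n*n≡m)
open import Data.Nat.Combinatorics using (_C_; nCn≡1; nCk≡n!/k![n-k]!; k![n∸k]!∣n!)
open import Data.Nat.Divisibility using (_∣_; _∤_; divides; _∣?_; ∣⇒≤; m∣m*n)
open import Data.Nat.Primality using (Prime; euclidsLemma; prime⇒nonTrivial; prime⇒nonZero; prime⇒irreducible)
open import Data.Nat.Coprimality using (Coprime; coprime-Bézout)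
open import Data.Nat.GCD using (module Bézout)
open import Data.Fin as Fin using (Fin; toℕ; fromℕ; fromℕ<)
open import Data.Fin.Properties using (toℕ-fromℕ; toℕ-fromℕ<; any?)
open import Data.List using (List; []; _∷_; map; length; applyUpTo)
open import Data.List.Properties using (length-map; length-applyUpTo)
open import Data.Nat.Induction using (<-wellFounded)
open import Induction.WellFounded using (Acc; acc)
open import Data.Product using (∃; ∃₂; _,_; proj₁; proj₂)
open import Data.Sum using (inj₁; inj₂)
open import Data.Vec.Functional using (Vector; tail)
open import Function using (_∘_)
open import Relation.Binary.Definitions using (tri<; tri≈; tri>)
open import Relation.Nullary using (Dec; yes; no; contradiction)
open import Relation.Binary.PropositionalEquality as ≡ using (_≡_; _≢_)
import Relation.Binary.Reasoning.Setoid as SetoidReasoning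

prime⇒1<p : ∀ {p} → Prime p → 1 < p
prime⇒1<p {p} p-prime = ℕ.nonTrivial⇒n>1 p {{prime⇒nonTrivial p-prime}}

prime∤m! : ∀ {p} → Prime p → ∀ m → m < p → p ∤ m !
prime∤m! p-prime zero m<p p∣1 = ℕₚ.<⇒≱ (prime⇒1<p p-prime) (∣⇒≤ p∣1)
prime∤m! p-prime (suc m) m<p p∣m! with euclidsLemma (suc m) (m !) p-prime p∣m!
... | inj₁ p∣1+m = ℕₚ.<⇒≱ m<p (∣⇒≤ p∣1+m)
... | inj₂ p∣m!  = prime∤m! p-prime m (ℕₚ.<-trans (ℕₚ.n<1+n m) m<p) p∣m!

n∣n! : ∀ {n} → .{{NonZero n}} → n ∣ n !
n∣n! {suc n} = m∣m*n (n !)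

nCk*[k!*[n∸k]!]≡n! : ∀ {n k} → k ≤ n → (n C k) ℕ.* (k ! ℕ.* (n ℕ.∸ k) !) ≡ n !
nCk*[k!*[n∸k]!]≡n! {n} {k} k≤n =
  ≡.trans (≡.cong (ℕ._* (k ! ℕ.* (n ℕ.∸ k) !)) (nCk≡n!/k![n-k]! k≤n)) (m/n*n≡m (k![n∸k]!∣n! k≤n))
  where instance _ = k !* (n ℕ.∸ k) !≢0

prime∣pCk : ∀ {p k} → Prime p → 0 < k → k < p → p ∣ p C k
prime∣pCk {p} {k} p-prime 0<k k<p
  with euclidsLemma (p C k) (k ! ℕ.* (p ℕ.∸ k) !) p-prime
         (≡.subst (p ∣_) (≡.sym (nCk*[k!*[n∸k]!]≡n! (ℕₚ.<⇒≤ k<p))) (n∣n! {{prime⇒nonZero p-prime}}))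
... | inj₁ p∣pCk = p∣pCk
... | inj₂ p∣k!*[p∸k]! with euclidsLemma (k !) ((p ℕ.∸ k) !) p-prime p∣k!*[p∸k]!
...   | inj₁ p∣k!     = contradiction p∣k! (prime∤m! p-prime k k<p)
...   | inj₂ p∣[p∸k]! = contradiction p∣[p∸k]! (prime∤m! p-prime (p ℕ.∸ k) (ℕₚ.∸-monoʳ-< 0<k (ℕₚ.<⇒≤ k<p)))

prime∤⇒coprime : ∀ {p n} → Prime p → p ∤ n → Coprime p n
prime∤⇒coprime p-prime p∤n (d∣p , d∣n) with prime⇒irreducible p-prime d∣p
... | inj₁ d≡1    = d≡1
... | inj₂ ≡.refl = contradiction d∣n p∤n

module Powers {p : ℕ} (1<p : 1 < p) where

  ^-injective : ∀ {i j} → p ℕ.^ i ≡ p ℕ.^ j → i ≡ j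
  ^-injective {i} {j} e with ℕₚ.<-cmp i j
  ... | tri< i<j _ _ = contradiction e (ℕₚ.<⇒≢ (ℕₚ.^-monoʳ-< p 1<p i<j))
  ... | tri≈ _ i≡j _ = i≡j
  ... | tri> _ _ j<i = contradiction (≡.sym e) (ℕₚ.<⇒≢ (ℕₚ.^-monoʳ-< p 1<p j<i))

  n<p^n : ∀ n → n < p ℕ.^ n
  n<p^n zero    = z<s
  n<p^n (suc n) = ℕₚ.≤-<-trans (n<p^n n) (ℕₚ.^-monoʳ-< p 1<p (ℕₚ.n<1+n n))

  isPower? : ∀ n → Dec (∃ λ i → n ≡ p ℕ.^ i)
  isPower? n with any? (λ (i : Fin (suc n)) → n ℕₚ.≟ p ℕ.^ toℕ i)
  ... | yes (i , n≡p^i) = yes (toℕ i , n≡p^i)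
  ... | no ¬small = no λ (i , n≡p^i) → notPower i n≡p^i
    where
    notPower : ∀ i → n ≢ p ℕ.^ i
    notPower i n≡p^i with i ℕₚ.<? suc n
    ... | yes i≤n = ¬small (fromℕ< i≤n , ≡.trans n≡p^i (≡.cong (p ℕ.^_) (≡.sym (toℕ-fromℕ< i≤n))))
    ... | no  i≰n = ℕₚ.<⇒≢ (ℕₚ.<-trans (ℕₚ.≮⇒≥ i≰n) (n<p^n i)) n≡p^i

module Frobenius {a ℓ} (R : CommutativeRing a ℓ) where
  open CommutativeRing R
  open import Algebra.Properties.Semiring.Mult semiring using (_×_; ×-congʳ; ×-assoc-*; ×1-homo-*; ×-homo-1)
  open import Algebra.Properties.Semiring.Exp semiring using (_^_)
  open import Algebra.Properties.CommutativeSemiring.Binomial commutativeSemiring using (theorem; binomialTerm)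
  open import Algebra.Properties.Monoid.Sum +-monoid using (sum)
  open SetoidReasoning setoid

  sum-onlyLast : ∀ n (u : Vector Carrier (suc n)) → (∀ i → toℕ i < n → u i ≈ 0#) → sum u ≈ u (fromℕ n)
  sum-onlyLast zero    u _      = +-identityʳ (u Fin.zero)
  sum-onlyLast (suc n) u u≈0 = begin
    u Fin.zero + sum (tail u) ≈⟨ +-congʳ (u≈0 Fin.zero z<s) ⟩
    0# + sum (tail u)         ≈⟨ +-identityˡ _ ⟩
    sum (tail u)              ≈⟨ sum-onlyLast n (tail u) (λ i i<n → u≈0 (Fin.suc i) (s<s i<n)) ⟩
    u (fromℕ (suc n))         ∎

  middleBinomials≈0⇒^-distrib-+ : ∀ n → 0 < n → (∀ {k} z → 0 < k → k < n → (n C k) × z ≈ 0#) →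
                                  ∀ x y → (x + y) ^ n ≈ x ^ n + y ^ n
  middleBinomials≈0⇒^-distrib-+ (suc q) _ middle≈0 x y = begin
    (x + y) ^ n                                                 ≈⟨ theorem n x y ⟩
    binomialTerm x y n Fin.zero + sum (tail (binomialTerm x y n))
      ≈⟨ +-congˡ (sum-onlyLast q _ λ i i<q → middle≈0 (x ^ suc (toℕ i) * y ^ (n ℕ.∸ suc (toℕ i))) z<s (s<s i<q)) ⟩
    binomialTerm x y n Fin.zero + binomialTerm x y n (fromℕ n)    ≈⟨ +-comm _ _ ⟩
    binomialTerm x y n (fromℕ n) + binomialTerm x y n Fin.zero    ≈⟨ +-cong lastTerm firstTerm ⟩
    x ^ n + y ^ n                                               ∎
    where
    n = suc q
    firstTerm : binomialTerm x y n Fin.zero ≈ y ^ n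
    firstTerm = begin
      1 × (1# * y ^ n) ≈⟨ ×-homo-1 _ ⟩
      1# * y ^ n       ≈⟨ *-identityˡ _ ⟩
      y ^ n            ∎
    lastTerm : binomialTerm x y n (fromℕ n) ≈ x ^ n
    lastTerm = begin
      (n C toℕ (fromℕ n)) × (x ^ toℕ (fromℕ n) * y ^ (n ℕ.∸ toℕ (fromℕ n)))
        ≡⟨ ≡.cong (λ k → (n C k) × (x ^ k * y ^ (n ℕ.∸ k))) (toℕ-fromℕ n) ⟩
      (n C n) × (x ^ n * y ^ (n ℕ.∸ n))
        ≡⟨ ≡.cong₂ (λ c k → c × (x ^ n * y ^ k)) (nCn≡1 n) (ℕₚ.n∸n≡0 n) ⟩
      1 × (x ^ n * 1#) ≈⟨ ×-homo-1 _ ⟩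
      x ^ n * 1#       ≈⟨ *-identityʳ _ ⟩
      x ^ n            ∎

  char∣n⇒n×x≈0 : ∀ {p n} → p × 1# ≈ 0# → p ∣ n → ∀ x → n × x ≈ 0#
  char∣n⇒n×x≈0 {p} char-p (divides q ≡.refl) x = begin
    (q ℕ.* p) × x           ≈⟨ ×-congʳ (q ℕ.* p) (*-identityˡ x) ⟨
    (q ℕ.* p) × (1# * x)    ≈⟨ ×-assoc-* (q ℕ.* p) 1# x ⟨
    ((q ℕ.* p) × 1#) * x    ≈⟨ *-congʳ (×1-homo-* q p) ⟩
    (q × 1#) * (p × 1#) * x ≈⟨ *-congʳ (*-congˡ char-p) ⟩
    (q × 1#) * 0# * x       ≈⟨ *-congʳ (zeroʳ _) ⟩
    0# * x                  ≈⟨ zeroˡ x ⟩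
    0#                      ∎

  frobenius-+ : ∀ {p} → Prime p → p × 1# ≈ 0# → ∀ x y → (x + y) ^ p ≈ x ^ p + y ^ p
  frobenius-+ {p} p-prime char-p = middleBinomials≈0⇒^-distrib-+ p (ℕₚ.<-trans z<s (prime⇒1<p p-prime))
    λ z 0<k k<p → char∣n⇒n×x≈0 char-p (prime∣pCk p-prime 0<k k<p) z

module EuclideanStep {a ℓ} (R : CommutativeRing a ℓ) where
  open CommutativeRing R
  open import Algebra.Properties.Ring ring using (-‿distribˡ-*; -‿distribʳ-*)
  open import Algebra.Properties.AbelianGroup +-abelianGroup using (xyx⁻¹≈y)
  open import Algebra.Properties.CommutativeSemigroup +-commutativeSemigroup using (x∙yz≈y∙xz)
  open import Algebra.Properties.CommutativeSemigroup *-commutativeSemigroup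
    using () renaming (x∙yz≈y∙xz to *-x∙yz≈y∙xz)
  open SetoidReasoning setoid

  common-divisor-step : ∀ {a b r} q d u v → a ≈ q * b + r → b ≈ d * u → r ≈ d * v → a ≈ d * (q * u + v)
  common-divisor-step {a} {b} {r} q d u v a≈ b≈ r≈ = begin
    a                     ≈⟨ a≈ ⟩
    q * b + r             ≈⟨ +-cong (*-congˡ b≈) r≈ ⟩
    q * (d * u) + d * v   ≈⟨ +-congʳ (*-x∙yz≈y∙xz q d u) ⟩
    d * (q * u) + d * v   ≈⟨ distribˡ d (q * u) v ⟨
    d * (q * u + v)       ∎

  bézout-step : ∀ {a b r d} q x y → a ≈ q * b + r → d ≈ b * x + r * y → d ≈ a * y + b * (x - q * y)
  bézout-step {a} {b} {r} {d} q x y a≈ d≈ = begin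
    d                                   ≈⟨ d≈ ⟩
    b * x + r * y                       ≈⟨ +-congˡ (*-congʳ r≈) ⟩
    b * x + (a - q * b) * y             ≈⟨ +-congˡ (distribʳ y a (- (q * b))) ⟩
    b * x + (a * y + - (q * b) * y)     ≈⟨ +-congˡ (+-congˡ moveNegation) ⟩
    b * x + (a * y + b * - (q * y))     ≈⟨ x∙yz≈y∙xz (b * x) (a * y) _ ⟩
    a * y + (b * x + b * - (q * y))     ≈⟨ +-congˡ (distribˡ b x (- (q * y))) ⟨
    a * y + b * (x - q * y)             ∎
    where
    r≈ : r ≈ a - q * b
    r≈ = trans (sym (xyx⁻¹≈y (q * b) r)) (+-congʳ (sym a≈))
    moveNegation : - (q * b) * y ≈ b * - (q * y)
    moveNegation = begin
      - (q * b) * y   ≈⟨ -‿distribˡ-* (q * b) y ⟨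
      - (q * b * y)   ≈⟨ -‿cong (trans (*-congʳ (*-comm q b)) (*-assoc b q y)) ⟩
      - (b * (q * y)) ≈⟨ -‿distribʳ-* b (q * y) ⟩
      b * - (q * y)   ∎

module PolynomialRing {c ℓ} (F : FiniteField c ℓ) where
  open FiniteField F hiding (zero)
  open FF F

  -- Wrapping _≈P_ (a Π-type) in a record lets Agda infer the two polynomials.
  infix 4 _≋_
  record _≋_ (f g : Poly) : Set ℓ where
    constructor coeffwise
    field at : f ≈P g
  open _≋_ public

  coeff-beyond : ∀ f {n} → length f ≤ n → coeff f n ≡ 0#
  coeff-beyond []      _         = ≡.refl
  coeff-beyond (a ∷ f) (s≤s f≤n) = coeff-beyond f f≤n

  ≋-refl : ∀ {f} → f ≋ f
  ≋-refl = coeffwise λ _ → refl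

  ≋-sym : ∀ {f g} → f ≋ g → g ≋ f
  ≋-sym f≋g = coeffwise λ n → sym (at f≋g n)

  ≋-trans : ∀ {f g h} → f ≋ g → g ≋ h → f ≋ h
  ≋-trans f≋g g≋h = coeffwise λ n → trans (at f≋g n) (at g≋h n)

  ∷-cong : ∀ {a b f g} → a ≈ b → f ≋ g → a ∷ f ≋ b ∷ g
  ∷-cong a≈b f≋g = coeffwise λ { zero → a≈b ; (suc n) → at f≋g n }

  [_] : Carrier → Poly
  [ a ] = a ∷ []

  X : Poly
  X = 0# ∷ 1# ∷ []

  scale : Carrier → Poly → Poly
  scale a = map (a *_)

  negate : Poly → Poly
  negate = map (-_)

  [0]≋[] : ∀ {a} → a ≈ 0# → [ a ] ≋ []
  [0]≋[] a≈0 = coeffwise λ { zero → a≈0 ; (suc n) → refl }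

  coeff-+P : ∀ f g n → coeff (f +P g) n ≈ coeff f n + coeff g n
  coeff-+P []      g       n       = sym (+-identityˡ _)
  coeff-+P (a ∷ f) []      n       = sym (+-identityʳ _)
  coeff-+P (a ∷ f) (b ∷ g) zero    = refl
  coeff-+P (a ∷ f) (b ∷ g) (suc n) = coeff-+P f g n

  coeff-scale : ∀ a f n → coeff (scale a f) n ≈ a * coeff f n
  coeff-scale a []      n       = sym (zeroʳ a)
  coeff-scale a (b ∷ f) zero    = refl
  coeff-scale a (b ∷ f) (suc n) = coeff-scale a f n

  coeff-negate : ∀ f n → coeff (negate f) n ≈ - coeff f n
  coeff-negate []      n       = sym ε⁻¹≈ε
    where open import Algebra.Properties.Group +-group using (ε⁻¹≈ε)
  coeff-negate (b ∷ f) zero    = refl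
  coeff-negate (b ∷ f) (suc n) = coeff-negate f n

  +P-cong : ∀ {f f′ g g′} → f ≋ f′ → g ≋ g′ → f +P g ≋ f′ +P g′
  +P-cong {f} {f′} {g} {g′} f≋f′ g≋g′ = coeffwise λ n →
    trans (coeff-+P f g n) (trans (+-cong (at f≋f′ n) (at g≋g′ n)) (sym (coeff-+P f′ g′ n)))

  +P-assoc : ∀ f g h → (f +P g) +P h ≋ f +P (g +P h)
  +P-assoc f g h = coeffwise λ n → begin
    coeff ((f +P g) +P h) n                ≈⟨ trans (coeff-+P (f +P g) h n) (+-congʳ (coeff-+P f g n)) ⟩
    (coeff f n + coeff g n) + coeff h n    ≈⟨ +-assoc _ _ _ ⟩
    coeff f n + (coeff g n + coeff h n)    ≈⟨ trans (coeff-+P f (g +P h) n) (+-congˡ (coeff-+P g h n)) ⟨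
    coeff (f +P (g +P h)) n                ∎
    where open SetoidReasoning setoid

  +P-comm : ∀ f g → f +P g ≋ g +P f
  +P-comm f g = coeffwise λ n → trans (coeff-+P f g n) (trans (+-comm _ _) (sym (coeff-+P g f n)))

  +P-congˡ : ∀ f {g g′} → g ≋ g′ → f +P g ≋ f +P g′
  +P-congˡ f = +P-cong ≋-refl

  +P-congʳ : ∀ g {f f′} → f ≋ f′ → f +P g ≋ f′ +P g
  +P-congʳ g f≋f′ = +P-cong f≋f′ ≋-refl

  +P-identityʳ : ∀ f → f +P [] ≋ f
  +P-identityʳ f = coeffwise λ n → trans (coeff-+P f [] n) (+-identityʳ _)

  negate-cong : ∀ {f g} → f ≋ g → negate f ≋ negate g
  negate-cong {f} {g} f≋g = coeffwise λ n →
    trans (coeff-negate f n) (trans (-‿cong (at f≋g n)) (sym (coeff-negate g n)))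

  negate-inverseˡ : ∀ f → negate f +P f ≋ []
  negate-inverseˡ f = coeffwise λ n →
    trans (coeff-+P (negate f) f n) (trans (+-congʳ (coeff-negate f n)) (-‿inverseˡ _))

  negate-inverseʳ : ∀ f → f +P negate f ≋ []
  negate-inverseʳ f = ≋-trans (+P-comm f (negate f)) (negate-inverseˡ f)

  +P-isAbelianGroup : IsAbelianGroup _≋_ _+P_ [] negate
  +P-isAbelianGroup = record
    { isGroup = record
      { isMonoid = record
        { isSemigroup = record
          { isMagma = record
            { isEquivalence = record { refl = ≋-refl ; sym = ≋-sym ; trans = ≋-trans }
            ; ∙-cong = +P-cong }
          ; assoc = +P-assoc }
        ; identity = (λ _ → ≋-refl) , +P-identityʳ }
      ; inverse = negate-inverseˡ , negate-inverseʳ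
      ; ⁻¹-cong = negate-cong }
    ; comm = +P-comm }

  +P-abelianGroup : AbelianGroup c ℓ
  +P-abelianGroup = record { isAbelianGroup = +P-isAbelianGroup }

  open import Algebra.Properties.CommutativeSemigroup (AbelianGroup.commutativeSemigroup +P-abelianGroup)
    using (interchange; x∙yz≈y∙xz)

  scale-congˡ : ∀ {a b} g → a ≈ b → scale a g ≋ scale b g
  scale-congˡ {a} {b} g a≈b = coeffwise λ n →
    trans (coeff-scale a g n) (trans (*-congʳ a≈b) (sym (coeff-scale b g n)))

  scale-congʳ : ∀ a {f g} → f ≋ g → scale a f ≋ scale a g
  scale-congʳ a {f} {g} f≋g = coeffwise λ n →
    trans (coeff-scale a f n) (trans (*-congˡ (at f≋g n)) (sym (coeff-scale a g n)))

  scale-zero : ∀ g → scale 0# g ≋ []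
  scale-zero g = coeffwise λ n → trans (coeff-scale 0# g n) (zeroˡ _)

  scale-assoc : ∀ a b g → scale (a * b) g ≋ scale a (scale b g)
  scale-assoc a b g = coeffwise λ n → trans (coeff-scale (a * b) g n)
    (trans (*-assoc a b _) (sym (trans (coeff-scale a (scale b g) n) (*-congˡ (coeff-scale b g n)))))

  scale-distribʳ : ∀ a b g → scale (a + b) g ≋ scale a g +P scale b g
  scale-distribʳ a b g = coeffwise λ n → begin
    coeff (scale (a + b) g) n                 ≈⟨ coeff-scale (a + b) g n ⟩
    (a + b) * coeff g n                       ≈⟨ distribʳ _ a b ⟩
    a * coeff g n + b * coeff g n             ≈⟨ +-cong (coeff-scale a g n) (coeff-scale b g n) ⟨
    coeff (scale a g) n + coeff (scale b g) n ≈⟨ coeff-+P (scale a g) (scale b g) n ⟨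
    coeff (scale a g +P scale b g) n          ∎
    where open SetoidReasoning setoid

  scale-distribˡ : ∀ a f g → scale a (f +P g) ≋ scale a f +P scale a g
  scale-distribˡ a f g = coeffwise λ n → begin
    coeff (scale a (f +P g)) n                ≈⟨ coeff-scale a (f +P g) n ⟩
    a * coeff (f +P g) n                      ≈⟨ *-congˡ (coeff-+P f g n) ⟩
    a * (coeff f n + coeff g n)               ≈⟨ distribˡ a _ _ ⟩
    a * coeff f n + a * coeff g n             ≈⟨ +-cong (coeff-scale a f n) (coeff-scale a g n) ⟨
    coeff (scale a f) n + coeff (scale a g) n ≈⟨ coeff-+P (scale a f) (scale a g) n ⟨
    coeff (scale a f +P scale a g) n          ∎
    where open SetoidReasoning setoid

  *P-zeroʳ : ∀ f → f *P [] ≋ []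
  *P-zeroʳ []      = ≋-refl
  *P-zeroʳ (a ∷ f) = coeffwise λ { zero → refl ; (suc n) → at (*P-zeroʳ f) n }

  ≋[]⇒*P≋[] : ∀ {f} g → f ≋ [] → f *P g ≋ []
  ≋[]⇒*P≋[] {[]}    g f≋[] = ≋-refl
  ≋[]⇒*P≋[] {a ∷ f} g f≋[] = begin
    scale a g +P (0# ∷ f *P g) ≈⟨ +P-cong (≋-trans (scale-congˡ g (at f≋[] zero)) (scale-zero g))
                                         (∷-cong refl (≋[]⇒*P≋[] {f} g (coeffwise λ n → at f≋[] (suc n)))) ⟩
    [] +P [ 0# ]               ≈⟨ [0]≋[] refl ⟩
    []                         ∎
    where open SetoidReasoning (AbelianGroup.setoid +P-abelianGroup)

  *P-congˡ : ∀ {f f′} g → f ≋ f′ → f *P g ≋ f′ *P g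
  *P-congˡ {[]}    {f′}     g f≋f′ = ≋-sym (≋[]⇒*P≋[] g (≋-sym f≋f′))
  *P-congˡ {a ∷ f} {[]}     g f≋f′ = ≋[]⇒*P≋[] g f≋f′
  *P-congˡ {a ∷ f} {b ∷ f′} g f≋f′ =
    +P-cong (scale-congˡ g (at f≋f′ zero)) (∷-cong refl (*P-congˡ {f} {f′} g (coeffwise λ n → at f≋f′ (suc n))))

  *P-congʳ : ∀ f {g g′} → g ≋ g′ → f *P g ≋ f *P g′
  *P-congʳ []      g≋g′ = ≋-refl
  *P-congʳ (a ∷ f) g≋g′ = +P-cong (scale-congʳ a g≋g′) (∷-cong refl (*P-congʳ f g≋g′))

  *P-distribʳ : ∀ g f f′ → (f +P f′) *P g ≋ f *P g +P f′ *P g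
  *P-distribʳ g []      f′       = ≋-refl
  *P-distribʳ g (a ∷ f) []       = ≋-sym (+P-identityʳ _)
  *P-distribʳ g (a ∷ f) (b ∷ f′) = ≋-trans
    (+P-cong (scale-distribʳ a b g) (∷-cong (sym (+-identityʳ 0#)) (*P-distribʳ g f f′)))
    (interchange (scale a g) (scale b g) (0# ∷ f *P g) (0# ∷ f′ *P g))

  *P-∷ : ∀ f b g → f *P (b ∷ g) ≋ scale b f +P (0# ∷ f *P g)
  *P-∷ []      b g = ≋-sym ([0]≋[] refl)
  *P-∷ (a ∷ f) b g = ∷-cong (+-congʳ (*-comm a b))
    (≋-trans (+P-cong ≋-refl (*P-∷ f b g)) (x∙yz≈y∙xz (scale a g) (scale b f) (0# ∷ f *P g)))

  *P-comm : ∀ f g → f *P g ≋ g *P f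
  *P-comm []      g = ≋-sym (*P-zeroʳ g)
  *P-comm (a ∷ f) g = ≋-trans (+P-cong ≋-refl (∷-cong refl (*P-comm f g))) (≋-sym (*P-∷ g a f))

  scale-*P : ∀ a g h → scale a g *P h ≋ scale a (g *P h)
  scale-*P a []      h = ≋-refl
  scale-*P a (b ∷ g) h = ≋-trans
    (+P-cong (scale-assoc a b h) (∷-cong (sym (zeroʳ a)) (scale-*P a g h)))
    (≋-sym (scale-distribˡ a (scale b h) (0# ∷ g *P h)))

  0∷-*P : ∀ f h → (0# ∷ f) *P h ≋ 0# ∷ f *P h
  0∷-*P f h = +P-cong (scale-zero h) ≋-refl

  *P-assoc : ∀ f g h → (f *P g) *P h ≋ f *P (g *P h)
  *P-assoc []      g h = ≋-refl
  *P-assoc (a ∷ f) g h = ≋-trans (*P-distribʳ h (scale a g) (0# ∷ f *P g))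
    (+P-cong (scale-*P a g h) (≋-trans (0∷-*P (f *P g) h) (∷-cong refl (*P-assoc f g h))))

  *P-identityˡ : ∀ g → [ 1# ] *P g ≋ g
  *P-identityˡ g = ≋-trans (+P-cong (coeffwise λ n → trans (coeff-scale 1# g n) (*-identityˡ _)) ([0]≋[] refl))
                           (+P-identityʳ g)

  [a]*P≋scale : ∀ a f → [ a ] *P f ≋ scale a f
  [a]*P≋scale a f = ≋-trans (+P-cong ≋-refl ([0]≋[] refl)) (+P-identityʳ (scale a f))

  X*P : ∀ f → X *P f ≋ 0# ∷ f
  X*P f = ≋-trans (0∷-*P [ 1# ] f) (∷-cong refl (*P-identityˡ f))

  *P-identityʳ : ∀ g → g *P [ 1# ] ≋ g
  *P-identityʳ g = ≋-trans (*P-comm g _) (*P-identityˡ g)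

  *P-distribˡ : ∀ g f f′ → g *P (f +P f′) ≋ g *P f +P g *P f′
  *P-distribˡ g f f′ =
    ≋-trans (*P-comm g _) (≋-trans (*P-distribʳ g f f′) (+P-cong (*P-comm f g) (*P-comm f′ g)))

  F[X] : CommutativeRing c ℓ
  F[X] = record
    { isCommutativeRing = record
      { isRing = record
        { +-isAbelianGroup = +P-isAbelianGroup
        ; *-cong = λ {f} {f′} {g} f≋f′ g≋g′ → ≋-trans (*P-congˡ g f≋f′) (*P-congʳ f′ g≋g′)
        ; *-assoc = *P-assoc
        ; *-identity = *P-identityˡ , *P-identityʳ
        ; distrib = *P-distribˡ , *P-distribʳ }
      ; *-comm = *P-comm } }

  private module P = CommutativeRing F[X]
  open import Algebra.Properties.Semiring.Exp P.semiring public using (_^_; ^-congˡ; ^-congʳ)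
  open import Algebra.Properties.CommutativeSemigroup P.*-commutativeSemigroup
    using () renaming (x∙yz≈y∙xz to *P-x∙yz≈y∙xz)

  [*] : ∀ a b → [ a * b ] ≋ [ a ] *P [ b ]
  [*] a b = ∷-cong (sym (+-identityʳ _)) ≋-refl

  ∘P-+P : ∀ u v f → (u +P v) ∘P f ≋ u ∘P f +P v ∘P f
  ∘P-+P []      v       f = ≋-refl
  ∘P-+P (a ∷ u) []      f = ≋-sym (+P-identityʳ _)
  ∘P-+P (a ∷ u) (b ∷ v) f =
    ≋-trans (+P-cong ≋-refl (≋-trans (*P-congʳ f (∘P-+P u v f)) (*P-distribˡ f _ _)))
            (interchange [ a ] [ b ] (f *P (u ∘P f)) (f *P (v ∘P f)))

  ≋[]⇒∘P≋[] : ∀ {u} f → u ≋ [] → u ∘P f ≋ []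
  ≋[]⇒∘P≋[] {[]}    f u≋[] = ≋-refl
  ≋[]⇒∘P≋[] {a ∷ u} f u≋[] = +P-cong ([0]≋[] (at u≋[] zero))
    (≋-trans (*P-congʳ f (≋[]⇒∘P≋[] {u} f (coeffwise λ n → at u≋[] (suc n)))) (*P-zeroʳ f))

  ∘P-congˡ : ∀ {u u′} f → u ≋ u′ → u ∘P f ≋ u′ ∘P f
  ∘P-congˡ {[]}    {u′}     f u≋u′ = ≋-sym (≋[]⇒∘P≋[] f (≋-sym u≋u′))
  ∘P-congˡ {a ∷ u} {[]}     f u≋u′ = ≋[]⇒∘P≋[] f u≋u′
  ∘P-congˡ {a ∷ u} {b ∷ u′} f u≋u′ = +P-cong (∷-cong (at u≋u′ zero) ≋-refl)
    (*P-congʳ f (∘P-congˡ {u} {u′} f (coeffwise λ n → at u≋u′ (suc n))))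

  ∘P-congʳ : ∀ u {f f′} → f ≋ f′ → u ∘P f ≋ u ∘P f′
  ∘P-congʳ []      f≋f′ = ≋-refl
  ∘P-congʳ (a ∷ u) f≋f′ = +P-cong ≋-refl (P.*-cong f≋f′ (∘P-congʳ u f≋f′))

  [_]-∘P : ∀ a f → [ a ] ∘P f ≋ [ a ]
  [ a ]-∘P f = ≋-trans (+P-cong ≋-refl (*P-zeroʳ f)) (+P-identityʳ _)

  X-∘P : ∀ f → X ∘P f ≋ f
  X-∘P f = ≋-trans (+P-cong ([0]≋[] refl) (*P-congʳ f ([ 1# ]-∘P f))) (*P-identityʳ f)

  scale-∘P : ∀ a u f → scale a u ∘P f ≋ [ a ] *P (u ∘P f)
  scale-∘P a []      f = ≋-sym (*P-zeroʳ [ a ])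
  scale-∘P a (b ∷ u) f = begin
    [ a * b ] +P f *P (scale a u ∘P f)         ≈⟨ +P-cong ([*] a b) (*P-congʳ f (scale-∘P a u f)) ⟩
    [ a ] *P [ b ] +P f *P ([ a ] *P (u ∘P f)) ≈⟨ +P-cong ≋-refl (*P-x∙yz≈y∙xz f [ a ] (u ∘P f)) ⟩
    [ a ] *P [ b ] +P [ a ] *P (f *P (u ∘P f)) ≈⟨ *P-distribˡ [ a ] [ b ] (f *P (u ∘P f)) ⟨
    [ a ] *P ([ b ] +P f *P (u ∘P f))          ∎
    where open SetoidReasoning P.setoid

  ∘P-*P : ∀ u v f → (u *P v) ∘P f ≋ (u ∘P f) *P (v ∘P f)
  ∘P-*P []      v f = ≋-refl
  ∘P-*P (a ∷ u) v f = begin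
    (scale a v +P (0# ∷ u *P v)) ∘P f                ≈⟨ ∘P-+P (scale a v) _ f ⟩
    scale a v ∘P f +P ([ 0# ] +P f *P ((u *P v) ∘P f))
      ≈⟨ +P-cong (scale-∘P a v f) (+P-cong ([0]≋[] refl) (*P-congʳ f (∘P-*P u v f))) ⟩
    [ a ] *P (v ∘P f) +P f *P ((u ∘P f) *P (v ∘P f))  ≈⟨ +P-cong ≋-refl (P.*-assoc f _ _) ⟨
    [ a ] *P (v ∘P f) +P (f *P (u ∘P f)) *P (v ∘P f)  ≈⟨ *P-distribʳ (v ∘P f) [ a ] (f *P (u ∘P f)) ⟨
    ([ a ] +P f *P (u ∘P f)) *P (v ∘P f)              ∎
    where open SetoidReasoning P.setoid

  ∘P-^ : ∀ u n f → (u ^ n) ∘P f ≋ (u ∘P f) ^ n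
  ∘P-^ u zero    f = [ 1# ]-∘P f
  ∘P-^ u (suc n) f = ≋-trans (∘P-*P u (u ^ n) f) (P.*-cong (≋-refl {u ∘P f}) (∘P-^ u n f))

  coeff-[a]*P : ∀ a f n → coeff ([ a ] *P f) n ≈ a * coeff f n
  coeff-[a]*P a f n = trans (at ([a]*P≋scale a f) n) (coeff-scale a f n)

  coeff-X^m-m : ∀ m → coeff (X ^ m) m ≈ 1#
  coeff-X^m-m zero    = refl
  coeff-X^m-m (suc m) = trans (at (X*P (X ^ m)) (suc m)) (coeff-X^m-m m)

  coeff-X^m-≢ : ∀ {m n} → n ≢ m → coeff (X ^ m) n ≈ 0#
  coeff-X^m-≢ {zero}  {zero}  n≢m = contradiction ≡.refl n≢m
  coeff-X^m-≢ {zero}  {suc n} n≢m = refl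
  coeff-X^m-≢ {suc m} {zero}  n≢m = at (X*P (X ^ m)) zero
  coeff-X^m-≢ {suc m} {suc n} n≢m = trans (at (X*P (X ^ m)) (suc n)) (coeff-X^m-≢ (n≢m ∘ ≡.cong suc))

module NatToF {c ℓ} (F : FiniteField c ℓ) where
  open FiniteField F hiding (zero)
  open FF F
  open SetoidReasoning setoid

  natToF-+ : ∀ m n → natToF (m ℕ.+ n) ≈ natToF m + natToF n
  natToF-+ zero    n = sym (+-identityˡ _)
  natToF-+ (suc m) n = trans (+-congˡ (natToF-+ m n)) (sym (+-assoc _ _ _))

  natToF-* : ∀ m n → natToF (m ℕ.* n) ≈ natToF m * natToF n
  natToF-* zero    n = sym (zeroˡ _)
  natToF-* (suc m) n = begin
    natToF (n ℕ.+ m ℕ.* n)         ≈⟨ natToF-+ n (m ℕ.* n) ⟩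
    natToF n + natToF (m ℕ.* n)    ≈⟨ +-cong (sym (*-identityˡ _)) (natToF-* m n) ⟩
    1# * natToF n + natToF m * natToF n ≈⟨ distribʳ _ _ _ ⟨
    natToF (suc m) * natToF n      ∎

module PrimeField {c ℓ} (F : FiniteField c ℓ) {p} (p-prime : Prime p)
                  (char-p : FiniteField._≈_ F (FF.natToF F p) (FiniteField.0# F)) where
  open FiniteField F hiding (zero)
  open FF F
  open NatToF F
  open import Algebra.Properties.Group +-group using (inverseʳ-unique; ⁻¹-involutive)
  open import Algebra.Properties.Ring ring using (-‿distribˡ-*; -‿distribʳ-*; -1*x≈-x)
  open SetoidReasoning setoid

  natToF-multiple : ∀ {n} → p ∣ n → natToF n ≈ 0#
  natToF-multiple (divides q ≡.refl) = trans (natToF-* q p) (trans (*-congˡ char-p) (zeroʳ _))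

  natToF[p∸1]≈-1 : natToF (p ℕ.∸ 1) ≈ - 1#
  natToF[p∸1]≈-1 = inverseʳ-unique 1# _
    (trans (reflexive (≡.cong natToF (ℕₚ.suc-pred p {{prime⇒nonZero p-prime}}))) char-p)

  natToF-[p∸1]* : ∀ n → natToF ((p ℕ.∸ 1) ℕ.* n) ≈ - natToF n
  natToF-[p∸1]* n = begin
    natToF ((p ℕ.∸ 1) ℕ.* n)      ≈⟨ natToF-* (p ℕ.∸ 1) n ⟩
    natToF (p ℕ.∸ 1) * natToF n   ≈⟨ *-congʳ natToF[p∸1]≈-1 ⟩
    - 1# * natToF n               ≈⟨ -1*x≈-x _ ⟩
    - natToF n                    ∎

  natToF-inverse : ∀ {n} → p ∤ n → ∃ λ m → natToF n * natToF m ≈ 1#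
  natToF-inverse {n} p∤n with coprime-Bézout (prime∤⇒coprime p-prime p∤n)
  ... | Bézout.-+ x y 1+xp≡yn = y , (begin
    natToF n * natToF y      ≈⟨ *-comm _ _ ⟩
    natToF y * natToF n      ≈⟨ natToF-* y n ⟨
    natToF (y ℕ.* n)         ≡⟨ ≡.cong natToF 1+xp≡yn ⟨
    1# + natToF (x ℕ.* p)    ≈⟨ +-congˡ (natToF-multiple (divides x ≡.refl)) ⟩
    1# + 0#                  ≈⟨ +-identityʳ 1# ⟩
    1#                       ∎)
  ... | Bézout.+- x y 1+yn≡xp = (p ℕ.∸ 1) ℕ.* y , (begin
    natToF n * natToF ((p ℕ.∸ 1) ℕ.* y) ≈⟨ *-congˡ (natToF-[p∸1]* y) ⟩
    natToF n * - natToF y               ≈⟨ -‿distribʳ-* _ _ ⟨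
    - (natToF n * natToF y)             ≈⟨ -‿cong (trans (*-comm _ _) (sym (natToF-* y n))) ⟩
    - natToF (y ℕ.* n)                  ≈⟨ -‿cong (inverseʳ-unique 1# _ (trans (reflexive (≡.cong natToF 1+yn≡xp))
                                                                    (natToF-multiple (divides x ≡.refl)))) ⟩
    - - 1#                              ≈⟨ ⁻¹-involutive 1# ⟩
    1#                                  ∎)

  -[x*y]*z≈-x : ∀ {x y z} → z * y ≈ 1# → - (x * y) * z ≈ - x
  -[x*y]*z≈-x {x} {y} {z} zy≈1 = begin
    - (x * y) * z ≈⟨ -‿distribˡ-* (x * y) z ⟨
    - (x * y * z) ≈⟨ -‿cong (trans (*-assoc x y z) (*-congˡ (trans (*-comm y z) zy≈1))) ⟩
    - (x * 1#)    ≈⟨ -‿cong (*-identityʳ x) ⟩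
    - x           ∎

  natToF≈0⇒p∣ : ∀ {n} → natToF n ≈ 0# → p ∣ n
  natToF≈0⇒p∣ {n} n≈0 with p ∣? n
  ... | yes p∣n = p∣n
  ... | no  p∤n = let (m , nm≈1) = natToF-inverse p∤n in
    contradiction (trans (sym nm≈1) (trans (*-congʳ n≈0) (zeroˡ _))) 1≉0

module Linearised {c ℓ} (F : FiniteField c ℓ) {p} (p-prime : Prime p)
                  (char-p : FiniteField._≈_ F (FF.natToF F p) (FiniteField.0# F)) where
  open FiniteField F hiding (zero)
  open FF F
  open PolynomialRing F
  private module P = CommutativeRing F[X]
  open import Algebra.Properties.Semiring.Mult P.semiring using (_×_)
  open import Algebra.Properties.CommutativeSemiring.Exp P.commutativeSemiring using (^-distrib-*)
  open Frobenius F[X] using (frobenius-+)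
  open import Algebra.Properties.CommutativeSemigroup (AbelianGroup.commutativeSemigroup +P-abelianGroup)
    using (interchange)

  embed : List ℕ → Poly
  embed = map natToF

  n×[1]≋[natToF-n] : ∀ n → n × [ 1# ] ≋ [ natToF n ]
  n×[1]≋[natToF-n] zero    = ≋-sym ([0]≋[] refl)
  n×[1]≋[natToF-n] (suc n) = +P-cong ≋-refl (n×[1]≋[natToF-n] n)

  frobenius-+P : ∀ f g → (f +P g) ^ p ≋ f ^ p +P g ^ p
  frobenius-+P = frobenius-+ p-prime (≋-trans (n×[1]≋[natToF-n] p) ([0]≋[] char-p))

  []^p≋[] : [] ^ p ≋ []
  []^p≋[] = ^-congʳ [] (≡.sym (ℕₚ.suc-pred p {{prime⇒nonZero p-prime}}))

  [1]^n≋[1] : ∀ n → [ 1# ] ^ n ≋ [ 1# ]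
  [1]^n≋[1] zero    = ≋-refl
  [1]^n≋[1] (suc n) = ≋-trans (*P-identityˡ _) ([1]^n≋[1] n)

  [natToF]^p : ∀ k → [ natToF k ] ^ p ≋ [ natToF k ]
  [natToF]^p zero    = ≋-trans (^-congˡ p ([0]≋[] refl)) (≋-trans []^p≋[] (≋-sym ([0]≋[] refl)))
  [natToF]^p (suc k) = ≋-trans (frobenius-+P [ 1# ] [ natToF k ]) (+P-cong ([1]^n≋[1] p) ([natToF]^p k))

  linearised : Poly → Poly → Poly
  linearised []       x = []
  linearised (a ∷ cs) x = [ a ] *P x +P linearised cs (x ^ p)

  linearised-congʳ : ∀ cs {x y} → x ≋ y → linearised cs x ≋ linearised cs y
  linearised-congʳ []       x≋y = ≋-refl
  linearised-congʳ (a ∷ cs) x≋y = +P-cong (*P-congʳ [ a ] x≋y) (linearised-congʳ cs (^-congˡ p x≋y))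

  ≋[]⇒linearised≋[] : ∀ {cs} x → cs ≋ [] → linearised cs x ≋ []
  ≋[]⇒linearised≋[] {[]}     x cs≋[] = ≋-refl
  ≋[]⇒linearised≋[] {a ∷ cs} x cs≋[] = +P-cong (≋[]⇒*P≋[] x ([0]≋[] (at cs≋[] zero)))
    (≋[]⇒linearised≋[] {cs} (x ^ p) (coeffwise λ n → at cs≋[] (suc n)))

  linearised-congˡ : ∀ {cs cs′} x → cs ≋ cs′ → linearised cs x ≋ linearised cs′ x
  linearised-congˡ {[]}     {cs′}     x cs≋cs′ = ≋-sym (≋[]⇒linearised≋[] x (≋-sym cs≋cs′))
  linearised-congˡ {a ∷ cs} {[]}      x cs≋cs′ = ≋[]⇒linearised≋[] x cs≋cs′
  linearised-congˡ {a ∷ cs} {b ∷ cs′} x cs≋cs′ = +P-cong (*P-congˡ x (∷-cong {f = []} (at cs≋cs′ zero) ≋-refl))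
    (linearised-congˡ {cs} {cs′} (x ^ p) (coeffwise λ n → at cs≋cs′ (suc n)))

  linearised-∘P : ∀ cs x f → linearised cs x ∘P f ≋ linearised cs (x ∘P f)
  linearised-∘P []       x f = ≋-refl
  linearised-∘P (a ∷ cs) x f = ≋-trans (∘P-+P ([ a ] *P x) (linearised cs (x ^ p)) f)
    (+P-cong (≋-trans (∘P-*P [ a ] x f) (*P-congˡ (x ∘P f) ([ a ]-∘P f)))
             (≋-trans (linearised-∘P cs (x ^ p) f) (linearised-congʳ cs (∘P-^ x p f))))

  linearised-additive : ∀ cs x y → linearised cs (x +P y) ≋ linearised cs x +P linearised cs y
  linearised-additive []       x y = ≋-refl
  linearised-additive (a ∷ cs) x y = ≋-trans
    (+P-cong (*P-distribˡ [ a ] x y)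
             (≋-trans (linearised-congʳ cs (frobenius-+P x y)) (linearised-additive cs (x ^ p) (y ^ p))))
    (interchange ([ a ] *P x) ([ a ] *P y) (linearised cs (x ^ p)) (linearised cs (y ^ p)))

  linearised-+P : ∀ u v x → linearised (u +P v) x ≋ linearised u x +P linearised v x
  linearised-+P []      v       x = ≋-refl
  linearised-+P (a ∷ u) []      x = ≋-sym (+P-identityʳ _)
  linearised-+P (a ∷ u) (b ∷ v) x = ≋-trans
    (+P-cong (*P-distribʳ x [ a ] [ b ]) (linearised-+P u v (x ^ p)))
    (interchange ([ a ] *P x) ([ b ] *P x) (linearised u (x ^ p)) (linearised v (x ^ p)))

  linearised-scale : ∀ a u x → linearised (scale a u) x ≋ [ a ] *P linearised u x
  linearised-scale a []      x = ≋-sym (*P-zeroʳ [ a ])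
  linearised-scale a (b ∷ u) x = ≋-trans
    (+P-cong (≋-trans (*P-congˡ x ([*] a b)) (*P-assoc [ a ] [ b ] x)) (linearised-scale a u (x ^ p)))
    (≋-sym (*P-distribˡ [ a ] ([ b ] *P x) (linearised u (x ^ p))))

  linearised-^p : ∀ cs x → linearised (embed cs) x ^ p ≋ linearised (embed cs) (x ^ p)
  linearised-^p []       x = []^p≋[]
  linearised-^p (k ∷ cs) x = ≋-trans (frobenius-+P ([ natToF k ] *P x) (linearised (embed cs) (x ^ p)))
    (+P-cong (≋-trans (^-distrib-* [ natToF k ] x p) (*P-congˡ (x ^ p) ([natToF]^p k)))
             (linearised-^p cs (x ^ p)))

  linearised-*P : ∀ u b x → linearised (u *P embed b) x ≋ linearised u (linearised (embed b) x)
  linearised-*P []      b x = ≋-refl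
  linearised-*P (a ∷ u) b x = ≋-trans (linearised-+P (scale a (embed b)) (0# ∷ u *P embed b) x)
    (+P-cong (linearised-scale a (embed b) x)
             (≋-trans (+P-cong (≋[]⇒*P≋[] x ([0]≋[] refl)) ≋-refl)
                      (≋-trans (linearised-*P u b (x ^ p)) (linearised-congʳ u (≋-sym (linearised-^p b x))))))

  associate : List ℕ → Poly
  associate cs = linearised (embed cs) X

  associate-∘P : ∀ cs f → associate cs ∘P f ≋ linearised (embed cs) f
  associate-∘P cs f = ≋-trans (linearised-∘P (embed cs) X f) (linearised-congʳ (embed cs) (X-∘P f))

module AdditivePolynomials {c ℓ} (F : FiniteField c ℓ) {p} (p-prime : Prime p)
                           (char-p : FiniteField._≈_ F (FF.natToF F p) (FiniteField.0# F)) where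
  open FiniteField F hiding (zero)
  open FF F
  open PolynomialRing F
  open Linearised F p-prime char-p
  open Powers (prime⇒1<p p-prime)
  open import Algebra.Properties.Semiring.Exp (CommutativeRing.semiring F[X]) using (^-assocʳ)

  X^p^ : ℕ → Poly
  X^p^ k = X ^ (p ℕ.^ k)

  X^p^k^p : ∀ k → X^p^ k ^ p ≋ X^p^ (suc k)
  X^p^k^p k = ≋-trans (^-assocʳ X (p ℕ.^ k) p) (^-congʳ X (ℕₚ.*-comm (p ℕ.^ k) p))

  coeff-linearised-∷ : ∀ a cs k n → coeff (linearised (a ∷ cs) (X^p^ k)) n
                                    ≈ a * coeff (X^p^ k) n + coeff (linearised cs (X^p^ (suc k))) n
  coeff-linearised-∷ a cs k n = trans (coeff-+P ([ a ] *P X^p^ k) (linearised cs (X^p^ k ^ p)) n)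
    (+-cong (coeff-[a]*P a (X^p^ k) n) (at (linearised-congʳ cs (X^p^k^p k)) n))

  coeff-linearised-nonPower : ∀ cs k n → (∀ j → n ≢ p ℕ.^ (k ℕ.+ j)) →
                              coeff (linearised cs (X^p^ k)) n ≈ 0#
  coeff-linearised-nonPower []       k n _        = refl
  coeff-linearised-nonPower (a ∷ cs) k n nonPower = begin
    coeff (linearised (a ∷ cs) (X^p^ k)) n                   ≈⟨ coeff-linearised-∷ a cs k n ⟩
    a * coeff (X^p^ k) n + coeff (linearised cs (X^p^ (suc k))) n
      ≈⟨ +-cong (*-congˡ (coeff-X^m-≢ λ n≡p^k →
                   nonPower 0 (≡.trans n≡p^k (≡.cong (p ℕ.^_) (≡.sym (ℕₚ.+-identityʳ k))))))
                (coeff-linearised-nonPower cs (suc k) n λ j n≡ →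
                   nonPower (suc j) (≡.trans n≡ (≡.cong (p ℕ.^_) (≡.sym (ℕₚ.+-suc k j))))) ⟩
    a * 0# + 0#                                              ≈⟨ trans (+-identityʳ _) (zeroʳ a) ⟩
    0#                                                       ∎
    where open SetoidReasoning setoid

  coeff-linearised-power : ∀ cs k j n → n ≡ p ℕ.^ (k ℕ.+ j) →
                           coeff (linearised (embed cs) (X^p^ k)) n ≈ coeff (embed cs) j
  coeff-linearised-power []       k j       n _  = refl
  coeff-linearised-power (a ∷ cs) k zero    n n≡ = begin
    coeff (linearised (embed (a ∷ cs)) (X^p^ k)) n                   ≈⟨ coeff-linearised-∷ (natToF a) (embed cs) k n ⟩
    natToF a * coeff (X^p^ k) n + coeff (linearised (embed cs) (X^p^ (suc k))) n
      ≈⟨ +-cong (*-congˡ (trans (reflexive (≡.cong (coeff (X^p^ k)) n≡p^k)) (coeff-X^m-m (p ℕ.^ k))))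
                (coeff-linearised-nonPower (embed cs) (suc k) n λ j n≡′ →
                   ℕₚ.m≢1+m+n k (^-injective (≡.trans (≡.sym n≡p^k) n≡′))) ⟩
    natToF a * 1# + 0#                                               ≈⟨ trans (+-identityʳ _) (*-identityʳ _) ⟩
    natToF a                                                         ∎
    where
    open SetoidReasoning setoid
    n≡p^k = ≡.trans n≡ (≡.cong (p ℕ.^_) (ℕₚ.+-identityʳ k))
  coeff-linearised-power (a ∷ cs) k (suc j) n n≡ = begin
    coeff (linearised (embed (a ∷ cs)) (X^p^ k)) n                   ≈⟨ coeff-linearised-∷ (natToF a) (embed cs) k n ⟩
    natToF a * coeff (X^p^ k) n + coeff (linearised (embed cs) (X^p^ (suc k))) n
      ≈⟨ +-cong (*-congˡ (coeff-X^m-≢ λ n≡p^k → ℕₚ.m+1+n≢m k (^-injective (≡.trans (≡.sym n≡) n≡p^k))))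
                (coeff-linearised-power cs (suc k) j n (≡.trans n≡ (≡.cong (p ℕ.^_) (ℕₚ.+-suc k j)))) ⟩
    natToF a * 0# + coeff (embed cs) j                               ≈⟨ trans (+-congʳ (zeroʳ _)) (+-identityˡ _) ⟩
    coeff (embed cs) j                                               ∎
    where open SetoidReasoning setoid

  embed-inPrimeField : ∀ cs → InPrimeField (embed cs)
  embed-inPrimeField []       j       = 0 , refl
  embed-inPrimeField (k ∷ cs) zero    = k , refl
  embed-inPrimeField (k ∷ cs) (suc j) = embed-inPrimeField cs j

  coeff-embed-applyUpTo : ∀ g L {i} → i < L → coeff (embed (applyUpTo g L)) i ≡ natToF (g i)
  coeff-embed-applyUpTo g (suc L) {zero}  _         = ≡.refl
  coeff-embed-applyUpTo g (suc L) {suc i} (s<s i<L) = coeff-embed-applyUpTo (g ∘ suc) L i<L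

  X≋X^p^0 : X ≋ X^p^ 0
  X≋X^p^0 = ≋-sym (*P-identityʳ X)

  coeff-associate-nonPower : ∀ cs n → (∀ j → n ≢ p ℕ.^ j) → coeff (associate cs) n ≈ 0#
  coeff-associate-nonPower cs n nonPower =
    trans (at (linearised-congʳ (embed cs) X≋X^p^0) n) (coeff-linearised-nonPower (embed cs) 0 n nonPower)

  coeff-associate-power : ∀ cs j → coeff (associate cs) (p ℕ.^ j) ≈ coeff (embed cs) j
  coeff-associate-power cs j =
    trans (at (linearised-congʳ (embed cs) X≋X^p^0) _) (coeff-linearised-power cs 0 j _ ≡.refl)

  associate-additiveFp : ∀ cs → AdditiveFp p (associate cs)
  associate-additiveFp cs = inPrimeField , coeff-associate-nonPower cs
    where
    inPrimeField : InPrimeField (associate cs)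
    inPrimeField n with isPower? n
    ... | yes (j , ≡.refl) = let (k , coeff≈k) = embed-inPrimeField cs j in
                             k , trans (coeff-associate-power cs j) coeff≈k
    ... | no ¬power        = 0 , coeff-associate-nonPower cs n λ j n≡p^j → ¬power (j , n≡p^j)

  additiveFp⇒associate : ∀ η → AdditiveFp p η → ∃ λ cs → η ≋ associate cs
  additiveFp⇒associate η (inPrimeField , additive) = cs , coeffwise coeff-η≈
    where
    cs = applyUpTo (λ i → proj₁ (inPrimeField (p ℕ.^ i))) (length η)

    coeff-η-power : ∀ i → coeff η (p ℕ.^ i) ≈ coeff (embed cs) i
    coeff-η-power i with i ℕₚ.<? length η
    ... | yes i<L = trans (proj₂ (inPrimeField (p ℕ.^ i)))
                          (reflexive (≡.sym (coeff-embed-applyUpTo _ (length η) i<L)))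
    ... | no  i≮L = reflexive (≡.trans (coeff-beyond η (ℕₚ.<⇒≤ (ℕₚ.≤-<-trans (ℕₚ.≮⇒≥ i≮L) (n<p^n i))))
                                       (≡.sym (coeff-beyond (embed cs) (ℕₚ.≤-trans length-embed-cs (ℕₚ.≮⇒≥ i≮L)))))
      where
      length-embed-cs : length (embed cs) ≤ length η
      length-embed-cs = ℕₚ.≤-reflexive (≡.trans (length-map natToF cs) (length-applyUpTo _ (length η)))

    coeff-η≈ : ∀ n → coeff η n ≈ coeff (associate cs) n
    coeff-η≈ n with isPower? n
    ... | yes (i , ≡.refl) = trans (coeff-η-power i) (sym (coeff-associate-power cs i))
    ... | no ¬power        = trans (additive n nonPower) (sym (coeff-associate-nonPower cs n nonPower))
      where
      nonPower : ∀ j → n ≢ p ℕ.^ j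
      nonPower j n≡p^j = ¬power (j , n≡p^j)

-- 𝔽ₚ[x] as lists of naturals (constant coefficient first), read in F[X] through embed.
module PrimeFieldPolynomials {c ℓ} (F : FiniteField c ℓ) {p} (p-prime : Prime p)
                             (char-p : FiniteField._≈_ F (FF.natToF F p) (FiniteField.0# F)) where
  open FiniteField F hiding (zero)
  open FF F
  open PolynomialRing F
  open NatToF F
  open PrimeField F p-prime char-p
  open Linearised F p-prime char-p using (embed)
  private module P = CommutativeRing F[X]
  open import Algebra.Properties.CommutativeSemigroup (AbelianGroup.commutativeSemigroup +P-abelianGroup)
    using () renaming (x∙yz≈y∙xz to +P-x∙yz≈y∙xz)
  open import Algebra.Properties.CommutativeSemigroup P.*-commutativeSemigroup
    using () renaming (x∙yz≈y∙xz to *P-x∙yz≈y∙xz)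
  open import Data.Product using (_×_)

  infixl 6 _⊕_
  infixl 7 _⊗_
  infix  8 ⊖_

  _⊕_ : List ℕ → List ℕ → List ℕ
  []      ⊕ b       = b
  (x ∷ a) ⊕ []      = x ∷ a
  (x ∷ a) ⊕ (y ∷ b) = (x ℕ.+ y) ∷ (a ⊕ b)

  _⊗_ : List ℕ → List ℕ → List ℕ
  []      ⊗ b = []
  (x ∷ a) ⊗ b = map (x ℕ.*_) b ⊕ (0 ∷ a ⊗ b)

  ⊖_ : List ℕ → List ℕ
  ⊖_ = map ((p ℕ.∸ 1) ℕ.*_)

  shift : ℕ → List ℕ → List ℕ
  shift zero    l = l
  shift (suc k) l = 0 ∷ shift k l

  lead : List ℕ → ℕ
  lead []           = 0
  lead (x ∷ [])     = x
  lead (x ∷ y ∷ ys) = lead (y ∷ ys)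

  -- Drops a leading coefficient that vanishes in 𝔽ₚ.
  _∷ₙ_ : ℕ → List ℕ → List ℕ
  x ∷ₙ [] with p ∣? x
  ... | yes _ = []
  ... | no  _ = x ∷ []
  x ∷ₙ (y ∷ ys) = x ∷ y ∷ ys

  normalise : List ℕ → List ℕ
  normalise []       = []
  normalise (x ∷ xs) = x ∷ₙ normalise xs

  ≋-reflexive : ∀ {f g} → f ≡ g → f ≋ g
  ≋-reflexive ≡.refl = ≋-refl

  embed-⊕ : ∀ a b → embed (a ⊕ b) ≋ embed a +P embed b
  embed-⊕ []      b       = ≋-refl
  embed-⊕ (x ∷ a) []      = ≋-refl
  embed-⊕ (x ∷ a) (y ∷ b) = ∷-cong (natToF-+ x y) (embed-⊕ a b)

  embed-map-* : ∀ x b → embed (map (x ℕ.*_) b) ≋ scale (natToF x) (embed b)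
  embed-map-* x []      = ≋-refl
  embed-map-* x (y ∷ b) = ∷-cong (natToF-* x y) (embed-map-* x b)

  embed-⊗ : ∀ a b → embed (a ⊗ b) ≋ embed a *P embed b
  embed-⊗ []      b = ≋-refl
  embed-⊗ (x ∷ a) b = ≋-trans (embed-⊕ (map (x ℕ.*_) b) (0 ∷ a ⊗ b))
                              (+P-cong (embed-map-* x b) (∷-cong refl (embed-⊗ a b)))

  embed-⊖ : ∀ a → embed (⊖ a) ≋ negate (embed a)
  embed-⊖ []      = ≋-refl
  embed-⊖ (x ∷ a) = ∷-cong (natToF-[p∸1]* x) (embed-⊖ a)

  embed-shift : ∀ k l → embed (shift k l) ≋ X ^ k *P embed l
  embed-shift zero    l = ≋-sym (*P-identityˡ (embed l))
  embed-shift (suc k) l = ≋-trans (∷-cong refl (embed-shift k l))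
                                  (≋-trans (≋-sym (X*P _)) (≋-sym (P.*-assoc X (X ^ k) (embed l))))

  embed-∷ₙ : ∀ x l → embed (x ∷ₙ l) ≋ natToF x ∷ embed l
  embed-∷ₙ x [] with p ∣? x
  ... | yes p∣x = ≋-sym ([0]≋[] (natToF-multiple p∣x))
  ... | no  _   = ≋-refl
  embed-∷ₙ x (y ∷ ys) = ≋-refl

  embed-normalise : ∀ l → embed (normalise l) ≋ embed l
  embed-normalise []       = ≋-refl
  embed-normalise (x ∷ xs) = ≋-trans (embed-∷ₙ x (normalise xs)) (∷-cong refl (embed-normalise xs))

  length-∷ₙ : ∀ x l → length (x ∷ₙ l) ≤ suc (length l)
  length-∷ₙ x [] with p ∣? x
  ... | yes _ = z≤n
  ... | no  _ = ℕₚ.≤-refl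
  length-∷ₙ x (y ∷ ys) = ℕₚ.≤-refl

  length-normalise : ∀ l → length (normalise l) ≤ length l
  length-normalise []       = z≤n
  length-normalise (x ∷ xs) = ℕₚ.≤-trans (length-∷ₙ x (normalise xs)) (s≤s (length-normalise xs))

  normalise-shrinks : ∀ l → 0 < length l → p ∣ lead l → length (normalise l) < length l
  normalise-shrinks (x ∷ []) _ p∣x with p ∣? x
  ... | yes _   = z<s
  ... | no  p∤x = contradiction p∣x p∤x
  normalise-shrinks (x ∷ y ∷ ys) _ p∣lead =
    ℕₚ.≤-<-trans (length-∷ₙ x (normalise (y ∷ ys))) (s<s (normalise-shrinks (y ∷ ys) z<s p∣lead))

  normalise-∷⇒p∤lead : ∀ l {y ys} → normalise l ≡ y ∷ ys → p ∤ lead (y ∷ ys)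
  normalise-∷⇒p∤lead (x ∷ xs) eq with normalise xs in eq′
  normalise-∷⇒p∤lead (x ∷ xs) eq | [] with p ∣? x
  normalise-∷⇒p∤lead (x ∷ xs) ≡.refl | [] | no p∤x = p∤x
  normalise-∷⇒p∤lead (x ∷ xs) ≡.refl | z ∷ zs = normalise-∷⇒p∤lead xs eq′

  length-⊕ : ∀ a b → length a ≡ length b → length (a ⊕ b) ≡ length a
  length-⊕ []      []      _   = ≡.refl
  length-⊕ (x ∷ a) (y ∷ b) |a|≡|b| = ≡.cong suc (length-⊕ a b (ℕₚ.suc-injective |a|≡|b|))

  lead-⊕ : ∀ a b → length a ≡ length b → lead (a ⊕ b) ≡ lead a ℕ.+ lead b
  lead-⊕ []           []           _       = ≡.refl
  lead-⊕ (x ∷ [])     (y ∷ [])     _       = ≡.refl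
  lead-⊕ (x ∷ x′ ∷ a) (y ∷ y′ ∷ b) |a|≡|b| = lead-⊕ (x′ ∷ a) (y′ ∷ b) (ℕₚ.suc-injective |a|≡|b|)

  length-shift : ∀ k l → length (shift k l) ≡ k ℕ.+ length l
  length-shift zero    l = ≡.refl
  length-shift (suc k) l = ≡.cong suc (length-shift k l)

  lead-∷ : ∀ x l → 0 < length l → lead (x ∷ l) ≡ lead l
  lead-∷ x (y ∷ l) _ = ≡.refl

  lead-shift : ∀ k l → 0 < length l → lead (shift k l) ≡ lead l
  lead-shift zero    l _   = ≡.refl
  lead-shift (suc k) l 0<l = ≡.trans (lead-∷ 0 (shift k l) (≡.subst (0 <_) (≡.sym (length-shift k l))
                                                               (ℕₚ.<-≤-trans 0<l (ℕₚ.m≤n+m _ k))))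
                                     (lead-shift k l 0<l)

  lead-map : ∀ f y ys → lead (map f (y ∷ ys)) ≡ f (lead (y ∷ ys))
  lead-map f y []        = ≡.refl
  lead-map f y (y′ ∷ ys) = lead-map f y′ ys

  embed-shift-[p∸1]* : ∀ k γ b → embed (shift k (map (((p ℕ.∸ 1) ℕ.* γ) ℕ.*_) b))
                                 ≋ negate (embed (shift k (γ ∷ [])) *P embed b)
  embed-shift-[p∸1]* k γ b = begin
    embed (shift k (map (((p ℕ.∸ 1) ℕ.* γ) ℕ.*_) b))   ≈⟨ embed-shift k _ ⟩
    X ^ k *P embed (map (((p ℕ.∸ 1) ℕ.* γ) ℕ.*_) b)     ≈⟨ *P-congʳ (X ^ k) (embed-map-* ((p ℕ.∸ 1) ℕ.* γ) b) ⟩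
    X ^ k *P scale (natToF ((p ℕ.∸ 1) ℕ.* γ)) (embed b) ≈⟨ *P-congʳ (X ^ k) ([a]*P≋scale _ (embed b)) ⟨
    X ^ k *P ([ natToF ((p ℕ.∸ 1) ℕ.* γ) ] *P embed b)
      ≈⟨ *P-congʳ (X ^ k) (*P-congˡ (embed b) (∷-cong {f = []} (natToF-[p∸1]* γ) ≋-refl)) ⟩
    X ^ k *P (negate [ natToF γ ] *P embed b)           ≈⟨ *P-congʳ (X ^ k) (-‿distribˡ-* [ natToF γ ] (embed b)) ⟨
    X ^ k *P negate ([ natToF γ ] *P embed b)           ≈⟨ -‿distribʳ-* (X ^ k) ([ natToF γ ] *P embed b) ⟨
    negate (X ^ k *P ([ natToF γ ] *P embed b))         ≈⟨ negate-cong (P.*-assoc (X ^ k) [ natToF γ ] (embed b)) ⟨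
    negate ((X ^ k *P [ natToF γ ]) *P embed b)         ≈⟨ negate-cong (*P-congˡ (embed b) (embed-shift k (γ ∷ []))) ⟨
    negate (embed (shift k (γ ∷ [])) *P embed b)        ∎
    where
    open SetoidReasoning P.setoid
    open import Algebra.Properties.Ring P.ring using (-‿distribˡ-*; -‿distribʳ-*)

  -- a′ = a - γ xᵏ b with γ = lead a / lead b and k = deg a - deg b, so the leading term of a cancels.
  reduce : ∀ a {y ys} → p ∤ lead (y ∷ ys) → length (y ∷ ys) ≤ length a →
           ∃₂ λ q a′ → length a′ < length a × embed a ≋ embed q *P embed (y ∷ ys) +P embed a′
  reduce a {y} {ys} p∤lead-b b≤a = shift k (γ ∷ []) , normalise (a ⊕ s) , shorter , a≋
    where
    b = y ∷ ys
    lead-b⁻¹ = natToF-inverse p∤lead-b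
    γ = lead a ℕ.* proj₁ lead-b⁻¹
    k = length a ℕ.∸ length b
    s = shift k (map (((p ℕ.∸ 1) ℕ.* γ) ℕ.*_) b)

    length-s : length s ≡ length a
    length-s = ≡.trans (length-shift k _) (≡.trans (≡.cong (k ℕ.+_) (length-map _ b)) (ℕₚ.m∸n+n≡m b≤a))

    lead-a⊕s≈0 : natToF (lead (a ⊕ s)) ≈ 0#
    lead-a⊕s≈0 = begin
      natToF (lead (a ⊕ s))
        ≡⟨ ≡.cong natToF (≡.trans (lead-⊕ a s (≡.sym length-s))
                                 (≡.cong (lead a ℕ.+_) (≡.trans (lead-shift k _ z<s) (lead-map _ y ys)))) ⟩
      natToF (lead a ℕ.+ (p ℕ.∸ 1) ℕ.* γ ℕ.* lead b)
        ≈⟨ trans (natToF-+ (lead a) ((p ℕ.∸ 1) ℕ.* γ ℕ.* lead b))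
                 (+-congˡ (trans (natToF-* ((p ℕ.∸ 1) ℕ.* γ) (lead b)) (*-congʳ (natToF-[p∸1]* γ)))) ⟩
      natToF (lead a) + - natToF γ * natToF (lead b)
        ≈⟨ +-congˡ (*-congʳ (-‿cong (natToF-* (lead a) _))) ⟩
      natToF (lead a) + - (natToF (lead a) * natToF (proj₁ lead-b⁻¹)) * natToF (lead b)
        ≈⟨ +-congˡ (-[x*y]*z≈-x (proj₂ lead-b⁻¹)) ⟩
      natToF (lead a) + - natToF (lead a)  ≈⟨ -‿inverseʳ _ ⟩
      0#                                   ∎
      where open SetoidReasoning setoid

    shorter : length (normalise (a ⊕ s)) < length a
    shorter = ≡.subst (length (normalise (a ⊕ s)) <_) |a⊕s|≡|a|
      (normalise-shrinks (a ⊕ s) (≡.subst (0 <_) (≡.sym |a⊕s|≡|a|) (ℕₚ.<-≤-trans z<s b≤a))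
                         (natToF≈0⇒p∣ lead-a⊕s≈0))
      where |a⊕s|≡|a| = length-⊕ a s (≡.sym length-s)

    a≋ : embed a ≋ embed (shift k (γ ∷ [])) *P embed b +P embed (normalise (a ⊕ s))
    a≋ = begin
      embed a                                            ≈⟨ xyx⁻¹≈y (Q *P embed b) (embed a) ⟨
      Q *P embed b +P embed a +P negate (Q *P embed b)   ≈⟨ P.+-assoc (Q *P embed b) (embed a) _ ⟩
      Q *P embed b +P (embed a +P negate (Q *P embed b)) ≈⟨ +P-congˡ (Q *P embed b) (+P-congˡ (embed a)
                                                                      (embed-shift-[p∸1]* k γ b)) ⟨
      Q *P embed b +P (embed a +P embed s)               ≈⟨ +P-congˡ (Q *P embed b)
                                                              (≋-trans (embed-normalise (a ⊕ s)) (embed-⊕ a s)) ⟨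
      Q *P embed b +P embed (normalise (a ⊕ s))          ∎
      where
      open SetoidReasoning P.setoid
      open import Algebra.Properties.AbelianGroup +P-abelianGroup using (xyx⁻¹≈y)
      Q = embed (shift k (γ ∷ []))

  division-step : ∀ {a a′ b} q q′ r → embed a ≋ embed q *P embed b +P embed a′ →
                  embed a′ ≋ embed q′ *P embed b +P embed r → embed a ≋ embed (q ⊕ q′) *P embed b +P embed r
  division-step {a} {a′} {b} q q′ r a≋ a′≋ = begin
    embed a                                        ≈⟨ a≋ ⟩
    embed q *P embed b +P embed a′                 ≈⟨ +P-congˡ (embed q *P embed b) a′≋ ⟩
    embed q *P embed b +P (embed q′ *P embed b +P embed r)
      ≈⟨ P.+-assoc (embed q *P embed b) (embed q′ *P embed b) (embed r) ⟨
    embed q *P embed b +P embed q′ *P embed b +P embed r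
      ≈⟨ +P-congʳ (embed r) (*P-distribʳ (embed b) (embed q) (embed q′)) ⟨
    (embed q +P embed q′) *P embed b +P embed r    ≈⟨ +P-congʳ (embed r) (*P-congˡ (embed b) (embed-⊕ q q′)) ⟨
    embed (q ⊕ q′) *P embed b +P embed r           ∎
    where open SetoidReasoning P.setoid

  divide : ∀ a {y ys} → p ∤ lead (y ∷ ys) →
           ∃₂ λ q r → length r < length (y ∷ ys) × embed a ≋ embed q *P embed (y ∷ ys) +P embed r
  divide a {y} {ys} p∤lead-b = go a (<-wellFounded (length a))
    where
    b = y ∷ ys
    go : ∀ a → Acc _<_ (length a) →
         ∃₂ λ q r → length r < length b × embed a ≋ embed q *P embed b +P embed r
    go a (acc rec) with length b ℕₚ.≤? length a
    ... | no  b≰a = [] , a , ℕₚ.≰⇒> b≰a , ≋-refl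
    ... | yes b≤a =
      let q , a′ , a′<a , a≋ = reduce a {y} {ys} p∤lead-b b≤a
          q′ , r , r<b , a′≋ = go a′ (rec a′<a)
      in q ⊕ q′ , r , r<b , division-step {b = b} q q′ r a≋ a′≋

  record GCD (a b : List ℕ) : Set ℓ where
    field
      gcd quotientˡ quotientʳ bézoutˡ bézoutʳ : List ℕ
      gcd∣ˡ  : embed a ≋ embed gcd *P embed quotientˡ
      gcd∣ʳ  : embed b ≋ embed gcd *P embed quotientʳ
      bézout : embed gcd ≋ embed a *P embed bézoutˡ +P embed b *P embed bézoutʳ

  embed-1 : embed (1 ∷ []) ≋ [ 1# ]
  embed-1 = ∷-cong (+-identityʳ 1#) ≋-refl

  GCD-zeroʳ : ∀ a {b} → embed b ≋ [] → GCD a b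
  GCD-zeroʳ a {b} b≋[] = record
    { gcd = a ; quotientˡ = 1 ∷ [] ; quotientʳ = [] ; bézoutˡ = 1 ∷ [] ; bézoutʳ = []
    ; gcd∣ˡ  = ≋-sym a·1≋a
    ; gcd∣ʳ  = ≋-trans b≋[] (≋-sym (*P-zeroʳ (embed a)))
    ; bézout = ≋-sym (≋-trans (+P-cong a·1≋a (*P-zeroʳ (embed b))) (+P-identityʳ (embed a)))
    }
    where
    a·1≋a : embed a *P embed (1 ∷ []) ≋ embed a
    a·1≋a = ≋-trans (*P-congʳ (embed a) embed-1) (*P-identityʳ (embed a))

  GCD-congʳ : ∀ {a b b′} → embed b ≋ embed b′ → GCD a b → GCD a b′
  GCD-congʳ {a} b≋b′ g = record
    { GCD g
    ; gcd∣ʳ  = ≋-trans (≋-sym b≋b′) gcd∣ʳ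
    ; bézout = ≋-trans bézout (+P-congˡ (embed a *P embed bézoutˡ) (*P-congˡ (embed bézoutʳ) b≋b′))
    }
    where open GCD g

  GCD-step : ∀ {a b} q r → embed a ≋ embed q *P embed b +P embed r → GCD b r → GCD a b
  GCD-step {a} {b} q r a≋ g = record
    { gcd = gcd ; quotientˡ = q ⊗ quotientˡ ⊕ quotientʳ ; quotientʳ = quotientˡ
    ; bézoutˡ = bézoutʳ ; bézoutʳ = bézoutˡ ⊕ ⊖ (q ⊗ bézoutʳ)
    ; gcd∣ˡ  = ≋-trans (common-divisor-step (embed q) (embed gcd) (embed quotientˡ) (embed quotientʳ) a≋ gcd∣ˡ gcd∣ʳ)
                       (*P-congʳ (embed gcd) (≋-sym embed-quotientˡ))
    ; gcd∣ʳ  = gcd∣ˡ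
    ; bézout = ≋-trans (bézout-step (embed q) (embed bézoutˡ) (embed bézoutʳ) a≋ bézout)
                       (+P-congˡ (embed a *P embed bézoutʳ) (*P-congʳ (embed b) (≋-sym embed-bézoutʳ)))
    }
    where
    open GCD g
    open EuclideanStep F[X] using (common-divisor-step; bézout-step)
    embed-quotientˡ : embed (q ⊗ quotientˡ ⊕ quotientʳ) ≋ embed q *P embed quotientˡ +P embed quotientʳ
    embed-quotientˡ =
      ≋-trans (embed-⊕ (q ⊗ quotientˡ) quotientʳ) (+P-congʳ (embed quotientʳ) (embed-⊗ q quotientˡ))
    embed-bézoutʳ : embed (bézoutˡ ⊕ ⊖ (q ⊗ bézoutʳ)) ≋ embed bézoutˡ +P negate (embed q *P embed bézoutʳ)
    embed-bézoutʳ = ≋-trans (embed-⊕ bézoutˡ _)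
      (+P-congˡ (embed bézoutˡ) (≋-trans (embed-⊖ (q ⊗ bézoutʳ)) (negate-cong (embed-⊗ q bézoutʳ))))

  euclid : ∀ a b → GCD a b
  euclid a b = go a b (<-wellFounded (length (normalise b)))
    where
    go : ∀ a b → Acc _<_ (length (normalise b)) → GCD a b
    go a b (acc rec) with normalise b in b≡
    ... | [] = GCD-zeroʳ a (≋-trans (≋-sym (embed-normalise b)) (≋-reflexive (≡.cong embed b≡)))
    ... | y ∷ ys with divide a {y} {ys} (normalise-∷⇒p∤lead b b≡)
    ...   | q , r , r<b , a≋ =
      GCD-congʳ {a} {y ∷ ys} {b} (≋-trans (≋-reflexive (≡.cong embed (≡.sym b≡))) (embed-normalise b))
                (GCD-step {a} {y ∷ ys} q r a≋ (go (y ∷ ys) r (rec (ℕₚ.≤-<-trans (length-normalise r) r<b))))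

module SumOfImages {c ℓ} (F : FiniteField c ℓ) {p} (p-prime : Prime p)
                   (char-p : FiniteField._≈_ F (FF.natToF F p) (FiniteField.0# F))
                   (η₁ η₂ : FF.Poly F) (η₁-additive : FF.AdditiveFp F p η₁)
                   (η₂-additive : FF.AdditiveFp F p η₂) where
  open FiniteField F hiding (zero)
  open FF F
  open PolynomialRing F
  open Linearised F p-prime char-p
  open AdditivePolynomials F p-prime char-p
  open PrimeFieldPolynomials F p-prime char-p
  private module P = CommutativeRing F[X]
  open SetoidReasoning P.setoid

  c₁ = proj₁ (additiveFp⇒associate η₁ η₁-additive)
  c₂ = proj₁ (additiveFp⇒associate η₂ η₂-additive)

  η₁-∘P : ∀ f → η₁ ∘P f ≋ linearised (embed c₁) f
  η₁-∘P f = ≋-trans (∘P-congˡ f (proj₂ (additiveFp⇒associate η₁ η₁-additive))) (associate-∘P c₁ f)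

  η₂-∘P : ∀ f → η₂ ∘P f ≋ linearised (embed c₂) f
  η₂-∘P f = ≋-trans (∘P-congˡ f (proj₂ (additiveFp⇒associate η₂ η₂-additive))) (associate-∘P c₂ f)

  open GCD (euclid c₁ c₂)

  η ζ₁ ζ₂ : Poly
  η  = associate gcd
  ζ₁ = associate bézoutˡ
  ζ₂ = associate bézoutʳ

  linearised-gcd : ∀ x → linearised (embed gcd) x
                         ≋ η₁ ∘P linearised (embed bézoutˡ) x +P η₂ ∘P linearised (embed bézoutʳ) x
  linearised-gcd x = begin
    linearised (embed gcd) x
      ≈⟨ linearised-congˡ x bézout ⟩
    linearised (embed c₁ *P embed bézoutˡ +P embed c₂ *P embed bézoutʳ) x
      ≈⟨ linearised-+P (embed c₁ *P embed bézoutˡ) _ x ⟩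
    linearised (embed c₁ *P embed bézoutˡ) x +P linearised (embed c₂ *P embed bézoutʳ) x
      ≈⟨ +P-cong (linearised-*P (embed c₁) bézoutˡ x) (linearised-*P (embed c₂) bézoutʳ x) ⟩
    linearised (embed c₁) (linearised (embed bézoutˡ) x) +P linearised (embed c₂) (linearised (embed bézoutʳ) x)
      ≈⟨ +P-cong (η₁-∘P _) (η₂-∘P _) ⟨
    η₁ ∘P linearised (embed bézoutˡ) x +P η₂ ∘P linearised (embed bézoutʳ) x ∎

  η-additiveFp : AdditiveFp p η
  η-additiveFp = associate-additiveFp gcd

  ζ₁-additiveFp : AdditiveFp p ζ₁
  ζ₁-additiveFp = associate-additiveFp bézoutˡ

  ζ₂-additiveFp : AdditiveFp p ζ₂
  ζ₂-additiveFp = associate-additiveFp bézoutʳ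

  η≈η₁∘ζ₁+η₂∘ζ₂ : η ≈P η₁ ∘P ζ₁ +P η₂ ∘P ζ₂
  η≈η₁∘ζ₁+η₂∘ζ₂ = at (linearised-gcd X)

  image⊆sum : ∀ h → h ∈Im η → InSum η₁ η₂ h
  image⊆sum h (f , h≈ηf) = ζ₁ ∘P f , ζ₂ ∘P f , at (begin
    h                                                   ≈⟨ coeffwise h≈ηf ⟩
    η ∘P f                                              ≈⟨ associate-∘P gcd f ⟩
    linearised (embed gcd) f                            ≈⟨ linearised-gcd f ⟩
    η₁ ∘P linearised (embed bézoutˡ) f +P η₂ ∘P linearised (embed bézoutʳ) f
      ≈⟨ +P-cong (∘P-congʳ η₁ (associate-∘P bézoutˡ f)) (∘P-congʳ η₂ (associate-∘P bézoutʳ f)) ⟨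
    η₁ ∘P (ζ₁ ∘P f) +P η₂ ∘P (ζ₂ ∘P f)                  ∎)

  sum⊆image : ∀ h → InSum η₁ η₂ h → h ∈Im η
  sum⊆image h (f , g , h≈) = linearised (embed quotientˡ) f +P linearised (embed quotientʳ) g , at (begin
    h                                                     ≈⟨ coeffwise h≈ ⟩
    η₁ ∘P f +P η₂ ∘P g                                    ≈⟨ +P-cong (η₁-∘P f) (η₂-∘P g) ⟩
    linearised (embed c₁) f +P linearised (embed c₂) g
      ≈⟨ +P-cong (linearised-congˡ f gcd∣ˡ) (linearised-congˡ g gcd∣ʳ) ⟩
    linearised (embed gcd *P embed quotientˡ) f +P linearised (embed gcd *P embed quotientʳ) g
      ≈⟨ +P-cong (linearised-*P (embed gcd) quotientˡ f) (linearised-*P (embed gcd) quotientʳ g) ⟩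
    linearised (embed gcd) (linearised (embed quotientˡ) f) +P linearised (embed gcd) (linearised (embed quotientʳ) g)
      ≈⟨ linearised-additive (embed gcd) _ _ ⟨
    linearised (embed gcd) (linearised (embed quotientˡ) f +P linearised (embed quotientʳ) g)
      ≈⟨ associate-∘P gcd _ ⟨
    η ∘P (linearised (embed quotientˡ) f +P linearised (embed quotientʳ) g) ∎)

open import Data.Product using (_×_)

lemma5p5 : ∀ {c ℓ} (F : FiniteField c ℓ) (p : ℕ) → Prime p →
    let open FiniteField F in let open FF F in
    natToF p ≈ 0# →
    (η₁ η₂ : Poly) → AdditiveFp p η₁ → AdditiveFp p η₂ →
    ∃ λ η → AdditiveFp p η
    × (∀ h → (h ∈Im η → InSum η₁ η₂ h) × (InSum η₁ η₂ h → h ∈Im η))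
    × (∃₂ λ ζ₁ ζ₂ → AdditiveFp p ζ₁ × AdditiveFp p ζ₂
    × (η ≈P (η₁ ∘P ζ₁) +P (η₂ ∘P ζ₂)))
lemma5p5 F p p-prime char-p η₁ η₂ η₁-additive η₂-additive =
  η , η-additiveFp , (λ h → image⊆sum h , sum⊆image h) ,
  ζ₁ , ζ₂ , ζ₁-additiveFp , ζ₂-additiveFp , η≈η₁∘ζ₁+η₂∘ζ₂
  where open SumOfImages F p-prime char-p η₁ η₂ η₁-additive η₂-additive
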